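{- Let $u=u_0u_1\dots u_{k-1}$ be a word over $\Sigma$ with $u_0=0$ and $k\ge2$, and let $\sigma=\mathrm{K}(u)$. If $\sigma$ is completely additive in the sense that $\sigma(nm-1)=\sigma(n-1)+\sigma(m-1)$ for all $n,m\ge1$, then $\sigma$ is the constant zero sequence.
   Context: $\Sigma$ is a fixed finite cyclic (additive) group. Keane product: $u\times\varepsilon=\varepsilon$, $u\times(av)=(u+a)(u\times v)$, where $u+a$ adds $a$ to each letter; $u^{\times0}=0$, $u^{\times(n+1)}=u\times u^{\times n}$; $\mathrm{K}(u)=\lim_nu^{\times n}$, indexed from $0$. -}

module Defs where

open import Data.Nat using (ℕ; zero; suc; _+_; _%_; _≤_)
open import Data.Nat.DivMod using (m%n<n)
open import Data.Fin using (Fin; toℕ; fromℕ<)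
open import Data.List using (List; []; _∷_; map; _++_)
open import Data.Maybe using (Maybe; just; nothing)
open import Data.Product using (∃)
open import Relation.Binary.PropositionalEquality using (_≡_)

-- The fixed finite cyclic group Σ = ℤ/(suc q)ℤ, represented as Fin (suc q).
Alph : ℕ → Set
Alph q = Fin (suc q)

_⊕_ : {q : ℕ} → Alph q → Alph q → Alph q
_⊕_ {q} a b = fromℕ< (m%n<n (toℕ a + toℕ b) (suc q))

𝟘 : {q : ℕ} → Alph q
𝟘 = Fin.zero
  where import Data.Fin as Fin

Word : ℕ → Set
Word q = List (Alph q)

shift : {q : ℕ} → Word q → Alph q → Word q
shift u a = map (_⊕ a) u

keane : {q : ℕ} → Word q → Word q → Word q
keane u []      = []
keane u (a ∷ v) = shift u a ++ keane u v

keanePow : {q : ℕ} → Word q → ℕ → Word q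
keanePow u zero    = 𝟘 ∷ []
keanePow u (suc n) = keane u (keanePow u n)

at : {q : ℕ} → Word q → ℕ → Maybe (Alph q)
at []      _       = nothing
at (x ∷ w) zero    = just x
at (x ∷ w) (suc i) = at w i

-- σ = K(u) = lim_n u^{×n}: every position i is eventually defined and
-- stabilises at the value σ i.
IsKeaneLimit : {q : ℕ} → Word q → (ℕ → Alph q) → Set
IsKeaneLimit u σ = ∀ i → ∃ λ N → ∀ n → N ≤ n → at (keanePow u n) i ≡ just (σ i)

module Submission where

-- The Keane product reads positions in base k: the letter of u × w at
-- position k·j + d is u_d + w_j.  Passing to the limit gives the digit law
--   σ(k·j + d) = u_d + σ(j)                                    (σ-digit)
-- so σ(i) is the sum of u over the base-k digits of i.  Complete additivity
-- with n = k + 1 and m = e·k² + 1 compares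
--   σ((k+1)(e·k²+1) − 1) = σ(e·k³ + e·k² + k)  (digits 0,1,e,e) = u₁ + 2u_e
-- with σ(k) + σ(e·k²) = u₁ + u_e; cancelling in the group gives u_e = 0 for
-- every letter (additive⇒letters-zero).  Finally, the Keane powers of an
-- all-zero word are all-zero words, so their limit vanishes
-- (zero-word⇒zero-limit).

open import Defs
open import Data.Nat using (ℕ; _*_; _∸_; _≤_)
open import Data.List using (_∷_; length)
open import Data.Maybe using (just)
open import Relation.Binary.PropositionalEquality using (_≡_)

open import Data.Nat using (zero; suc; _+_; _%_; _⊔_; s≤s; z≤n)
open import Data.Nat.Properties
  using (m∸n+n≡m; <⇒≤; m≤m⊔n; m≤n⊔m; m≤n⇒m≤1+n; ≤-refl; +-assoc; +-comm;
         +-identityʳ; *-zeroʳ; *-identityʳ; *-suc)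
open import Data.Nat.DivMod using (m%n<n; %-distribˡ-+; m%n%n≡m%n; [m+n]%n≡m%n; m<n⇒m%n≡m)
open import Data.Nat.Tactic.RingSolver using (solve-∀)
open import Data.Fin using (toℕ)
open import Data.Fin.Properties using (toℕ-injective; toℕ-fromℕ<; toℕ<n)
open import Data.List using ([]; map; _++_)
open import Data.List.Properties using (length-map)
open import Data.List.Relation.Unary.All as All using (All; []; _∷_)
open import Data.List.Relation.Unary.All.Properties using (map⁺; ++⁺)
open import Data.Maybe.Properties using (just-injective)
open import Data.Product using (_,_; ∃; proj₁; proj₂)
open import Relation.Binary.PropositionalEquality
  using (refl; sym; trans; cong; cong₂; module ≡-Reasoning)

module CyclicGroup (q : ℕ) where

  private
    M : ℕ
    M = suc q

  toℕ-⊕ : (a b : Alph q) → toℕ (a ⊕ b) ≡ (toℕ a + toℕ b) % M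
  toℕ-⊕ a b = toℕ-fromℕ< (m%n<n (toℕ a + toℕ b) M)

  [m+n%M]%M : ∀ m n → (m + n % M) % M ≡ (m + n) % M
  [m+n%M]%M m n = begin
    (m + n % M) % M         ≡⟨ %-distribˡ-+ m (n % M) M ⟩
    (m % M + n % M % M) % M ≡⟨ cong (λ r → (m % M + r) % M) (m%n%n≡m%n n M) ⟩
    (m % M + n % M) % M     ≡⟨ %-distribˡ-+ m n M ⟨
    (m + n) % M             ∎
    where open ≡-Reasoning

  ⊕-identityˡ : (a : Alph q) → 𝟘 ⊕ a ≡ a
  ⊕-identityˡ a = toℕ-injective (trans (toℕ-⊕ 𝟘 a) (m<n⇒m%n≡m (toℕ<n a)))

  ⊕-identityʳ : (a : Alph q) → a ⊕ 𝟘 ≡ a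
  ⊕-identityʳ a = toℕ-injective (begin
    toℕ (a ⊕ 𝟘)      ≡⟨ toℕ-⊕ a 𝟘 ⟩
    (toℕ a + 0) % M  ≡⟨ cong (_% M) (+-identityʳ (toℕ a)) ⟩
    toℕ a % M        ≡⟨ m<n⇒m%n≡m (toℕ<n a) ⟩
    toℕ a            ∎)
    where open ≡-Reasoning

  unshift : (a b : Alph q) → (M ∸ toℕ a + toℕ (a ⊕ b)) % M ≡ toℕ b
  unshift a b = begin
    (M ∸ A + toℕ (a ⊕ b)) % M  ≡⟨ cong (λ r → (M ∸ A + r) % M) (toℕ-⊕ a b) ⟩
    (M ∸ A + (A + B) % M) % M  ≡⟨ [m+n%M]%M (M ∸ A) (A + B) ⟩
    (M ∸ A + (A + B)) % M      ≡⟨ cong (_% M) (+-assoc (M ∸ A) A B) ⟨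
    (M ∸ A + A + B) % M        ≡⟨ cong (λ r → (r + B) % M) (m∸n+n≡m (<⇒≤ (toℕ<n a))) ⟩
    (M + B) % M                ≡⟨ cong (_% M) (+-comm M B) ⟩
    (B + M) % M                ≡⟨ [m+n]%n≡m%n B M ⟩
    B % M                      ≡⟨ m<n⇒m%n≡m (toℕ<n b) ⟩
    B                          ∎
    where
      open ≡-Reasoning
      A = toℕ a
      B = toℕ b

  ⊕-cancelˡ : (a b c : Alph q) → a ⊕ b ≡ a ⊕ c → b ≡ c
  ⊕-cancelˡ a b c ab≡ac = toℕ-injective (begin
    toℕ b                              ≡⟨ unshift a b ⟨
    (M ∸ toℕ a + toℕ (a ⊕ b)) % M      ≡⟨ cong (λ x → (M ∸ toℕ a + toℕ x) % M) ab≡ac ⟩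
    (M ∸ toℕ a + toℕ (a ⊕ c)) % M      ≡⟨ unshift a c ⟩
    toℕ c                              ∎)
    where open ≡-Reasoning

  absorbed⇒𝟘 : (a b : Alph q) → a ⊕ b ≡ a → b ≡ 𝟘
  absorbed⇒𝟘 a b ab≡a = ⊕-cancelˡ a b 𝟘 (trans ab≡a (sym (⊕-identityʳ a)))

at-++ʳ : ∀ {q} (xs ys : Word q) i → at (xs ++ ys) (length xs + i) ≡ at ys i
at-++ʳ []       ys i = refl
at-++ʳ (x ∷ xs) ys i = at-++ʳ xs ys i

at-++ˡ : ∀ {q} (xs ys : Word q) d {x} → at xs d ≡ just x → at (xs ++ ys) d ≡ just x
at-++ˡ (y ∷ xs) ys zero    xs[d]≡x = xs[d]≡x
at-++ˡ (y ∷ xs) ys (suc d) xs[d]≡x = at-++ˡ xs ys d xs[d]≡x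

at-shift : ∀ {q} (u : Word q) a d {x} → at u d ≡ just x → at (shift u a) d ≡ just (x ⊕ a)
at-shift (y ∷ u) a zero    u[d]≡x = cong (λ z → just (z ⊕ a)) (just-injective u[d]≡x)
at-shift (y ∷ u) a (suc d) u[d]≡x = at-shift u a d u[d]≡x

at-keane : ∀ {q} (u w : Word q) j d {a x} → at w j ≡ just a → at u d ≡ just x →
  at (keane u w) (length u * j + d) ≡ just (x ⊕ a)
at-keane u (b ∷ w) zero d w[0]≡a u[d]≡x
  rewrite *-zeroʳ (length u) | just-injective w[0]≡a =
  at-++ˡ (shift u _) (keane u w) d (at-shift u _ d u[d]≡x)
at-keane u (b ∷ w) (suc j) d w[j]≡a u[d]≡x = begin
  at (shift u b ++ keane u w) (length u * suc j + d)
    ≡⟨ cong (at (shift u b ++ keane u w)) position ⟩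
  at (shift u b ++ keane u w) (length (shift u b) + (length u * j + d))
    ≡⟨ at-++ʳ (shift u b) (keane u w) (length u * j + d) ⟩
  at (keane u w) (length u * j + d)
    ≡⟨ at-keane u w j d w[j]≡a u[d]≡x ⟩
  just _ ∎
  where
    open ≡-Reasoning
    position : length u * suc j + d ≡ length (shift u b) + (length u * j + d)
    position = begin
      length u * suc j + d              ≡⟨ cong (_+ d) (*-suc (length u) j) ⟩
      length u + length u * j + d       ≡⟨ +-assoc (length u) (length u * j) d ⟩
      length u + (length u * j + d)     ≡⟨ cong (_+ (length u * j + d)) (length-map (_⊕ b) u) ⟨
      length (shift u b) + (length u * j + d) ∎

σ-digit : ∀ {q} (u : Word q) (σ : ℕ → Alph q) → IsKeaneLimit u σ →
  ∀ j d {x} → at u d ≡ just x → σ (length u * j + d) ≡ x ⊕ σ j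
σ-digit u σ lim j d {x} u[d]≡x with lim j | lim (length u * j + d)
... | N₁ , stable₁ | N₂ , stable₂ = just-injective (begin
  just (σ (length u * j + d))        ≡⟨ stable₂ (suc n) (m≤n⇒m≤1+n (m≤n⊔m N₁ N₂)) ⟨
  at (keanePow u (suc n)) (length u * j + d)
    ≡⟨ at-keane u (keanePow u n) j d (stable₁ n (m≤m⊔n N₁ N₂)) u[d]≡x ⟩
  just (x ⊕ σ j)                     ∎)
  where
    open ≡-Reasoning
    n = N₁ ⊔ N₂

AllZero : ∀ {q} → Word q → Set
AllZero = All (_≡ 𝟘)

-- u × w consists of shifted copies of u, which stay zero when shifted by 0.
keane-zero : ∀ {q} (u w : Word q) → AllZero u → AllZero w → AllZero (keane u w)
keane-zero u []      zu []          = []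
keane-zero {q} u (b ∷ w) zu (refl ∷ zw) =
  ++⁺ (map⁺ (All.map (λ { refl → ⊕-identityˡ 𝟘 }) zu)) (keane-zero u w zu zw)
  where open CyclicGroup q

keanePow-zero : ∀ {q} (u : Word q) → AllZero u → ∀ n → AllZero (keanePow u n)
keanePow-zero u zu zero    = refl ∷ []
keanePow-zero u zu (suc n) = keane-zero u (keanePow u n) zu (keanePow-zero u zu n)

at-zero : ∀ {q} (w : Word q) i {x} → AllZero w → at w i ≡ just x → x ≡ 𝟘
at-zero (y ∷ w) zero    (y≡0 ∷ _)  w[i]≡x = trans (sym (just-injective w[i]≡x)) y≡0
at-zero (y ∷ w) (suc i) (_   ∷ zw) w[i]≡x = at-zero w i zw w[i]≡x

-- σ(i) is a letter of some Keane power, hence zero when u is all-zero.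
zero-word⇒zero-limit : ∀ {q} (u : Word q) (σ : ℕ → Alph q) → AllZero u →
  IsKeaneLimit u σ → ∀ i → σ i ≡ 𝟘
zero-word⇒zero-limit u σ zu lim i with lim i
... | N , stable = at-zero (keanePow u N) i (keanePow-zero u zu N) (stable N ≤-refl)

letters-zero⇒AllZero : ∀ {q} (u : Word q) → (∀ d {x} → at u d ≡ just x → x ≡ 𝟘) → AllZero u
letters-zero⇒AllZero []      _  = []
letters-zero⇒AllZero (y ∷ u) z = z 0 refl ∷ letters-zero⇒AllZero u (λ d → z (suc d))

-- Complete additivity of σ, as in the theorem (shifted to 0-indexing).
CompletelyAdditive : ∀ {q} → (ℕ → Alph q) → Set
CompletelyAdditive σ = ∀ n m → 1 ≤ n → 1 ≤ m → σ (n * m ∸ 1) ≡ σ (n ∸ 1) ⊕ σ (m ∸ 1)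

second-letter : ∀ {q} (u : Word q) → 2 ≤ length u → ∃ λ x → at u 1 ≡ just x
second-letter (a ∷ b ∷ u) _ = b , refl
second-letter (a ∷ []) (s≤s ())

-- The base-k expansions used: e·k² has digits (0,0,e) and
-- (k+1)(e·k²+1) − 1 = e·k³ + e·k² + k has digits (0,1,e,e).
digits-ek² : ∀ k e → e * k * k ≡ k * (k * e)
digits-ek² = solve-∀

digits-product : ∀ k e → e * k * k + k * suc (e * k * k) ≡ k * (k * (k * e + e) + 1)
digits-product = solve-∀

additive⇒letters-zero : ∀ {q} (u : Word q) (σ : ℕ → Alph q) →
  at u 0 ≡ just 𝟘 → 2 ≤ length u → IsKeaneLimit u σ → CompletelyAdditive σ →
  ∀ e {x} → at u e ≡ just x → x ≡ 𝟘
additive⇒letters-zero {q} u σ u₀≡0 k≥2 lim additive e {uₑ} u[e]≡uₑ =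
  absorbed⇒𝟘 uₑ uₑ (⊕-cancelˡ u₁ _ _ (begin
    u₁ ⊕ (uₑ ⊕ uₑ)          ≡⟨ σ-product ⟨
    σ (X + k * suc X)       ≡⟨ additive (suc k) (suc X) (s≤s z≤n) (s≤s z≤n) ⟩
    σ k ⊕ σ X               ≡⟨ cong₂ _⊕_ σ-k σ-ek² ⟩
    u₁ ⊕ uₑ                 ∎))
  where
    open CyclicGroup q
    open ≡-Reasoning
    k = length u
    X = e * k * k
    u₁ = proj₁ (second-letter u k≥2)
    u[1]≡u₁ = proj₂ (second-letter u k≥2)

    digit : ∀ {i} j d {x} → at u d ≡ just x → i ≡ k * j + d → σ i ≡ x ⊕ σ j
    digit j d u[d]≡x refl = σ-digit u σ lim j d u[d]≡x

    -- A trailing zero digit does not change σ, since u₀ = 0.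
    leading-zero : ∀ {i} j → i ≡ k * j → σ i ≡ σ j
    leading-zero j i≡kj =
      trans (digit j 0 u₀≡0 (trans i≡kj (sym (+-identityʳ (k * j))))) (⊕-identityˡ (σ j))

    σ-zero : σ 0 ≡ 𝟘
    σ-zero = absorbed⇒𝟘 (σ 0) (σ 0) (sym (additive 1 1 (s≤s z≤n) (s≤s z≤n)))

    single-digit : ∀ d {x} → at u d ≡ just x → σ d ≡ x
    single-digit d {x} u[d]≡x = begin
      σ d        ≡⟨ digit 0 d u[d]≡x (cong (_+ d) (sym (*-zeroʳ k))) ⟩
      x ⊕ σ 0    ≡⟨ cong (x ⊕_) σ-zero ⟩
      x ⊕ 𝟘      ≡⟨ ⊕-identityʳ x ⟩
      x          ∎

    σ-k : σ k ≡ u₁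
    σ-k = trans (leading-zero 1 (sym (*-identityʳ k))) (single-digit 1 u[1]≡u₁)

    σ-ek² : σ X ≡ uₑ
    σ-ek² = begin
      σ X         ≡⟨ leading-zero (k * e) (digits-ek² k e) ⟩
      σ (k * e)   ≡⟨ leading-zero e refl ⟩
      σ e         ≡⟨ single-digit e u[e]≡uₑ ⟩
      uₑ          ∎

    σ-product : σ (X + k * suc X) ≡ u₁ ⊕ (uₑ ⊕ uₑ)
    σ-product = begin
      σ (X + k * suc X)              ≡⟨ leading-zero (k * (k * e + e) + 1) (digits-product k e) ⟩
      σ (k * (k * e + e) + 1)        ≡⟨ digit (k * e + e) 1 u[1]≡u₁ refl ⟩
      u₁ ⊕ σ (k * e + e)             ≡⟨ cong (u₁ ⊕_) (digit e e u[e]≡uₑ refl) ⟩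
      u₁ ⊕ (uₑ ⊕ σ e)                ≡⟨ cong (λ s → u₁ ⊕ (uₑ ⊕ s)) (single-digit e u[e]≡uₑ) ⟩
      u₁ ⊕ (uₑ ⊕ uₑ)                 ∎

mainTheorem8 : (q : ℕ) (u : Word q) → at u 0 ≡ just 𝟘 → 2 ≤ length u →
    (σ : ℕ → Alph q) → IsKeaneLimit u σ →
    (∀ n m → 1 ≤ n → 1 ≤ m → σ (n * m ∸ 1) ≡ σ (n ∸ 1) ⊕ σ (m ∸ 1)) →
    ∀ i → σ i ≡ 𝟘
mainTheorem8 q u u₀≡0 k≥2 σ lim additive =
  zero-word⇒zero-limit u σ u-zero lim
  where
    u-zero : AllZero u
    u-zero = letters-zero⇒AllZero u (additive⇒letters-zero u σ u₀≡0 k≥2 lim additive)
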